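{- Let $P$ be a poset on $\{1,\ldots,n\}$, let $M$ be a maximum independent set of $G_P$, and let $F_M$ be the associated poset. Then for every $1\le j\le n$, $\Lambda_j^{F_M}=\{i : i\le_{F_M}j\}$ equals the unique $J\in M$ with $J\setminus\mu(M,J)=\{j\}$.
   Context: An order ideal of $P$ is a subset $J$ with $i\in J$, $j\le_P i\Rightarrow j\in J$; a nonempty order ideal is connected if the Hasse diagram of $P$ restricted to it is connected. Sets $A,B$ intersect nontrivially if $A\cap B\ne\emptyset$, $A\not\subseteq B$, $B\not\subseteq A$. $G_P$ is the simple graph whose vertices are the connected order ideals of $P$, adjacent iff they intersect nontrivially. A maximum independent set is an independent set of largest possible size. For $J\in M$, $\mu(M,J)=\bigcup_{J'\in M,\,J'\subsetneq J}J'$. For each $J\in M$, $J\setminus\mu(M,J)$ is a singleton, and distinct $J$ give distinct singletons whose union is $[n]$ (fact from the paper); write $J_i$ for the element of $M$ with $J_i\setminus\mu(M,J_i)=\{i\}$. $F_M$ is the poset on $[n]$ with $i<_{F_M}j$ iff $J_i\subsetneq J_j$. -}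

module Defs where

open import Data.Nat using (ℕ; _≤_)
open import Data.Fin using (Fin)
open import Data.Fin.Subset using (Subset; _∈_; _⊆_; _⊈_; _⊂_; _∩_; Nonempty)
open import Data.List using (List; length)
open import Data.List.Relation.Unary.All using (All)
open import Data.List.Relation.Unary.Unique.Propositional using (Unique)
open import Data.List.Membership.Propositional using () renaming (_∈_ to _∈ₗ_)
open import Data.Product using (_×_; ∃; Σ)
open import Data.Sum using (_⊎_)
open import Relation.Nullary using (¬_)
open import Relation.Binary.PropositionalEquality using (_≡_; _≢_)
open import Function.Bundles using (_⇔_)

module _ {n : ℕ} (_≼_ : Fin n → Fin n → Set) where

  IsOrderIdeal : Subset n → Set
  IsOrderIdeal J = ∀ {i j} → i ∈ J → j ≼ i → j ∈ J

  Covers : Fin n → Fin n → Set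
  Covers i j = (i ≼ j) × (i ≢ j) × (∀ k → i ≼ k → k ≼ j → (k ≡ i) ⊎ (k ≡ j))

  HasseAdj : Fin n → Fin n → Set
  HasseAdj i j = Covers i j ⊎ Covers j i

  data PathIn (J : Subset n) : Fin n → Fin n → Set where
    here : ∀ {a} → a ∈ J → PathIn J a a
    step : ∀ {a b c} → a ∈ J → HasseAdj a b → PathIn J b c → PathIn J a c

  HasseConnected : Subset n → Set
  HasseConnected J = ∀ a b → a ∈ J → b ∈ J → PathIn J a b

  -- connected order ideal = vertex of G_P
  IsConnectedOrderIdeal : Subset n → Set
  IsConnectedOrderIdeal J = IsOrderIdeal J × Nonempty J × HasseConnected J

IntersectNontrivially : {n : ℕ} → Subset n → Subset n → Set
IntersectNontrivially A B = Nonempty (A ∩ B) × (A ⊈ B) × (B ⊈ A)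

module _ {n : ℕ} (_≼_ : Fin n → Fin n → Set) where

  IsIndependentSet : List (Subset n) → Set
  IsIndependentSet M =
    Unique M × All (IsConnectedOrderIdeal _≼_) M
    × (∀ {A B} → A ∈ₗ M → B ∈ₗ M → ¬ IntersectNontrivially A B)

  IsMaximumIndependentSet : List (Subset n) → Set
  IsMaximumIndependentSet M =
    IsIndependentSet M × (∀ L → IsIndependentSet L → length L ≤ length M)

module _ {n : ℕ} (M : List (Subset n)) where

  -- x ∈ μ(M,J) = ⋃ { J' ∈ M | J' ⊊ J }
  InMu : Subset n → Fin n → Set
  InMu J x = Σ (Subset n) λ J' → J' ∈ₗ M × J' ⊂ J × x ∈ J'

  DiffIsSingleton : Subset n → Fin n → Set
  DiffIsSingleton J j = ∀ x → ((x ∈ J) × ¬ InMu J x) ⇔ (x ≡ j)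

-- The poset F_M, given the assignment i ↦ J_i :
-- i <_{F_M} j  iff  J_i ⊊ J_j ;  ≤ is its reflexive closure
module _ {n : ℕ} (Jof : Fin n → Subset n) where

  _<F_ : Fin n → Fin n → Set
  i <F j = Jof i ⊂ Jof j

  _≤F_ : Fin n → Fin n → Set
  i ≤F j = (i ≡ j) ⊎ (i <F j)

-- An independent set M is a laminar family. In a laminar family the private element j of a
-- member A (the unique element of A ∖ μ(M, A)) lies in a member B only if A ⊆ B. Hence J is the
-- unique member with private element j, and an element i ≠ j of J lies in some J′ ⊂ J, so that
-- J_i ⊆ J′ ⊂ J = J_j.
module Submission where

open import Defs
open import Data.Nat using (ℕ)
open import Data.Fin using (Fin)
open import Data.Fin.Subset using (Subset; _∈_)
open import Data.List using (List)
open import Data.List.Membership.Propositional using () renaming (_∈_ to _∈ₗ_)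
open import Data.Product using (_×_)
open import Relation.Binary.PropositionalEquality using (_≡_)
open import Relation.Binary.Structures using (IsPartialOrder)
open import Relation.Binary.Definitions using (Decidable)
open import Function.Bundles using (_⇔_)

open import Data.Fin.Properties using (_≟_; ¬∀⟶∃¬)
open import Data.Fin.Subset using (_∉_; _⊆_; _⊈_; _⊂_)
open import Data.Fin.Subset.Properties using (_∈?_; _⊆?_; _⊂?_; x∈p∩q⁺; ⊆-⊂-trans; ⊂-⊆-trans)
open import Data.List.Membership.Propositional using (find; lose)
open import Data.List.Relation.Unary.Any using (any?)
open import Data.Product using (∃; _,_; proj₁; proj₂)
open import Data.Sum using (_⊎_; inj₁; inj₂)
open import Function.Base using (_∘′_; const)
open import Function.Bundles using (mk⇔; Equivalence)
open import Relation.Binary.PropositionalEquality using (refl; _≢_)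
open import Relation.Nullary using (¬_; Dec; yes; no; contradiction; _×-dec_; _→-dec_)
open import Relation.Nullary.Decidable using (decidable-stable)

private
  variable
    n : ℕ
    p q A B J : Subset n
    M : List (Subset n)
    j x : Fin n

⊈⇒∃∉ : p ⊈ q → ∃ λ x → x ∈ p × x ∉ q
⊈⇒∃∉ {n} {p} {q} p⊈q
  with x , x∉p⇒q ← ¬∀⟶∃¬ n (λ x → x ∈ p → x ∈ q) (λ x → x ∈? p →-dec x ∈? q) (λ p⇒q → p⊈q (p⇒q _))
  = x , decidable-stable (x ∈? p) (λ x∉p → x∉p⇒q (λ x∈p → contradiction x∈p x∉p))
      , x∉p⇒q ∘′ const

⊆∧⊉⇒⊂ : p ⊆ q → q ⊈ p → p ⊂ q
⊆∧⊉⇒⊂ p⊆q q⊈p = p⊆q , ⊈⇒∃∉ q⊈p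

Laminar : List (Subset n) → Set
Laminar M = ∀ {A B} → A ∈ₗ M → B ∈ₗ M → ¬ IntersectNontrivially A B

independent⇒laminar : ∀ {_≼_ : Fin n → Fin n → Set} → IsIndependentSet _≼_ M → Laminar M
independent⇒laminar (_ , _ , laminar) = laminar

laminar-comparable : Laminar M → A ∈ₗ M → B ∈ₗ M → x ∈ A → x ∈ B → A ⊆ B ⊎ B ⊆ A
laminar-comparable {A = A} {B = B} laminar A∈M B∈M x∈A x∈B with A ⊆? B | B ⊆? A
... | yes A⊆B | _       = inj₁ A⊆B
... | no _    | yes B⊆A = inj₂ B⊆A
... | no A⊈B  | no B⊈A  = contradiction ((_ , x∈p∩q⁺ (x∈A , x∈B)) , A⊈B , B⊈A) (laminar A∈M B∈M)

InMu? : (M : List (Subset n)) (J : Subset n) (x : Fin n) → Dec (InMu M J x)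
InMu? M J x with any? (λ J′ → (J′ ⊂? J) ×-dec (x ∈? J′)) M
... | yes J′∈M = yes (let J′ , J′∈M , J′⊂J , x∈J′ = find J′∈M in J′ , J′∈M , J′⊂J , x∈J′)
... | no ∄J′   = no λ (_ , J′∈M , J′⊂J , x∈J′) → ∄J′ (lose J′∈M (J′⊂J , x∈J′))

private∈ : DiffIsSingleton M J j → j ∈ J
private∈ J-private = proj₁ (Equivalence.from (J-private _) refl)

private∉μ : DiffIsSingleton M J j → ¬ InMu M J j
private∉μ J-private = proj₂ (Equivalence.from (J-private _) refl)

nonprivate⇒InMu : DiffIsSingleton M J j → x ∈ J → x ≢ j → InMu M J x
nonprivate⇒InMu {M = M} {J = J} {x = x} J-private x∈J x≢j =
  decidable-stable (InMu? M J x) λ x∉μ → x≢j (Equivalence.to (J-private x) (x∈J , x∉μ))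

-- Laminarity makes A, B comparable; B ⊂ A is excluded because j would then lie in μ(M, A).
private∈⇒⊆ : Laminar M → A ∈ₗ M → B ∈ₗ M → DiffIsSingleton M A j → j ∈ B → A ⊆ B
private∈⇒⊆ {A = A} {B = B} laminar A∈M B∈M A-private j∈B
  with laminar-comparable laminar A∈M B∈M (private∈ A-private) j∈B | A ⊆? B
... | inj₁ A⊆B | _       = A⊆B
... | inj₂ _   | yes A⊆B = A⊆B
... | inj₂ B⊆A | no A⊈B  = contradiction (B , B∈M , ⊆∧⊉⇒⊂ B⊆A A⊈B , j∈B) (private∉μ A-private)

lemma2p4 : (n : ℕ) (_≼_ : Fin n → Fin n → Set)
    → IsPartialOrder _≡_ _≼_ → Decidable _≼_
    → (M : List (Subset n)) → IsMaximumIndependentSet _≼_ M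
    → (Jof : Fin n → Subset n)
    → (∀ i → (Jof i ∈ₗ M) × DiffIsSingleton M (Jof i) i)
    → ∀ (j : Fin n) (J : Subset n) → J ∈ₗ M → DiffIsSingleton M J j
    → ∀ (i : Fin n) → _≤F_ Jof i j ⇔ (i ∈ J)
lemma2p4 n _≼_ _ _ M (independent , _) Jof Jof-private j J J∈M J-private i = mk⇔ ≤F⇒∈ ∈⇒≤F
  where
  laminar = independent⇒laminar independent

  Jj⊆J : Jof j ⊆ J
  Jj⊆J = private∈⇒⊆ laminar (proj₁ (Jof-private j)) J∈M (proj₂ (Jof-private j)) (private∈ J-private)

  J⊆Jj : J ⊆ Jof j
  J⊆Jj = private∈⇒⊆ laminar J∈M (proj₁ (Jof-private j)) J-private (private∈ (proj₂ (Jof-private j)))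

  ≤F⇒∈ : _≤F_ Jof i j → i ∈ J
  ≤F⇒∈ (inj₁ refl)       = private∈ J-private
  ≤F⇒∈ (inj₂ (Ji⊆Jj , _)) = Jj⊆J (Ji⊆Jj (private∈ (proj₂ (Jof-private i))))

  ∈⇒≤F : i ∈ J → _≤F_ Jof i j
  ∈⇒≤F i∈J with i ≟ j
  ... | yes refl = inj₁ refl
  ... | no i≢j
    with J′ , J′∈M , J′⊂J , i∈J′ ← nonprivate⇒InMu J-private i∈J i≢j
    = inj₂ (⊆-⊂-trans Ji⊆J′ (⊂-⊆-trans J′⊂J J⊆Jj))
    where
    Ji⊆J′ : Jof i ⊆ J′
    Ji⊆J′ = private∈⇒⊆ laminar (proj₁ (Jof-private i)) J′∈M (proj₂ (Jof-private i)) i∈J′
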